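{- Let $p,q>0$ and $k\ge0$ be integers and let $\mathbf x(\mathbf y)\in\mathcal S_n(R)$ be a lasso sequence with $\mathbf x\in\mathbb{Z}^p$, $\mathbf y\in\mathbb{Z}^q$, satisfying $\phi^{(\ell)}(\mathbf x(\mathbf y))=0$ for $0\le\ell\le k-1$. Then, with $\mathbf e=(1,\dots,1)\in\mathbb{Z}^q$, $$M^k(\mathbf x(\mathbf y))=M^k(\mathbf x)\left(\sum_{\ell=1}^k S\big(M^{k-\ell}(\mathbf x)\big)M^{\ell-1}(\mathbf e)+M^k(\mathbf y)\right),$$ and $$\phi^{(k)}(\mathbf x(\mathbf y))=A\left(\sum_{\ell=1}^k S(M^{k-\ell}(\mathbf x))M^{\ell-1}(\mathbf e)+M^k(\mathbf y)\right)=\frac1q S\left(\sum_{\ell=1}^k S(M^{k-\ell}(\mathbf x))M^{\ell-1}(\mathbf e)+M^k(\mathbf y)\right)$$ $$=\frac1q\sum_{j=1}^p x_j\left[\binom{q+p-j+k}{k}-\binom{p-j+k}{k}\right]+\frac1q\sum_{i=1}^q\binom{k+q-i}{k}y_i.$$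
   Context: $\mathcal S_n(R)$ is the set of lasso sequences $\mathbf x(\mathbf y)$ with $\mathbf x\in[-R,R]^p$, $\mathbf y\in[-R,R]^q$, $p\ge0$, $q\ge1$, $p+q\le n$; $\mathbf u(\mathbf v)$ denotes the infinite sequence listing the finite sequence $\mathbf u$ and then repeating the finite sequence $\mathbf v$ cyclically forever. For a (finite or infinite) sequence, $M(\mathbf a)=(a_1,a_1+a_2,\dots)$ (same length if finite), $M^0$ is the identity, $M^k=M\circ M^{k-1}$; $S$ is the sum of a finite sequence; $A$ of a finite sequence is the average of its entries, and of an infinite sequence is $\liminf_T\frac1T\sum_{j\le T}a_j$; $\phi^{(k)}(\mathbf a)=A(M^k(\mathbf a))$. -}

module Defs where

open import Data.Nat as ℕ using (ℕ; zero; suc; _∸_; _<ᵇ_; NonZero)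
open import Data.Nat.DivMod using (_%_)
open import Data.Nat.Combinatorics using (_C_)
open import Data.Integer as ℤ using (ℤ; +_)
open import Data.Rational as ℚ using (ℚ; _/_)
open import Data.Fin using (Fin; toℕ; fromℕ<)
open import Data.Fin.Properties using ()
open import Data.Vec using (Vec; []; _∷_; lookup; tabulate; map; zipWith; replicate)
open import Data.Bool using (if_then_else_)
open import Data.Product using (Σ; ∃; _×_)
open import Function using (_∘_)
open import Data.Nat.DivMod using (m%n<n)
open import Relation.Nullary using (yes; no)

iter : ∀ {A : Set} → ℕ → (A → A) → A → A
iter zero    f a = a
iter (suc k) f a = f (iter k f a)

S : ∀ {n} → Vec ℤ n → ℤ
S []       = ℤ.0ℤ
S (a ∷ as) = a ℤ.+ S as

Mv : ∀ {n} → Vec ℤ n → Vec ℤ n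
Mv []       = []
Mv (a ∷ as) = a ∷ map (λ b → a ℤ.+ b) (Mv as)

-- Partial-sum operator M on infinite sequences (0-indexed: (M a) i = a 0 + … + a i).
sumUpTo : (ℕ → ℤ) → ℕ → ℤ
sumUpTo a zero    = ℤ.0ℤ
sumUpTo a (suc T) = sumUpTo a T ℤ.+ a T

Ms : (ℕ → ℤ) → (ℕ → ℤ)
Ms a i = sumUpTo a (suc i)

-- Lasso sequence u(v): u listed, then v repeated cyclically forever (0-indexed).
lasso : ∀ {p q} .{{_ : NonZero q}} → Vec ℤ p → Vec ℤ q → (ℕ → ℤ)
lasso {p} {q} u v i with i ℕ.<? p
... | yes h = lookup u (fromℕ< h)
... | no  _ = lookup v (fromℕ< (m%n<n (i ∸ p) q))

Afin : ∀ {q} .{{_ : NonZero q}} → Vec ℤ q → ℚ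
Afin {q} v = S v / q

-- Cesàro averages of an infinite sequence: avg a T = (1/(T+1)) Σ_{j=0}^{T} a j,
-- i.e. the average of the first T+1 entries.
avg : (ℕ → ℤ) → ℕ → ℚ
avg a T = sumUpTo a (suc T) / suc T

IsLiminf : (ℕ → ℚ) → ℚ → Set
IsLiminf b c =
  (∀ (ε : ℚ) → ℚ.Positive ε → ∃ λ N → ∀ T → N ℕ.≤ T → c ℚ.- ε ℚ.≤ b T)
  × (∀ (ε : ℚ) → ℚ.Positive ε → ∀ N → ∃ λ T → N ℕ.≤ T × b T ℚ.≤ c ℚ.+ ε)

-- A(a) = c  for an infinite sequence a:  liminf of its Cesàro averages equals c.
A∞≡ : (ℕ → ℤ) → ℚ → Set
A∞≡ a c = IsLiminf (avg a) c

φ≡ : ℕ → (ℕ → ℤ) → ℚ → Set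
φ≡ k a c = A∞≡ (iter k Ms a) c

_+v_ : ∀ {n} → Vec ℤ n → Vec ℤ n → Vec ℤ n
_+v_ = zipWith ℤ._+_

_·v_ : ∀ {n} → ℤ → Vec ℤ n → Vec ℤ n
c ·v v = map (λ b → c ℤ.* b) v

e : ∀ {q} → Vec ℤ q
e = replicate _ (ℤ.+ 1)

ΣvFrom1 : ∀ {q} → ℕ → (ℕ → Vec ℤ q) → Vec ℤ q
ΣvFrom1 zero    f = replicate _ ℤ.0ℤ
ΣvFrom1 (suc k) f = ΣvFrom1 k f +v f (suc k)

ΣFin : ∀ n → (Fin n → ℤ) → ℤ
ΣFin zero    f = ℤ.0ℤ
ΣFin (suc n) f = f Data.Fin.zero ℤ.+ ΣFin n (f ∘ Data.Fin.suc)

wvec : ∀ {p q} → ℕ → Vec ℤ p → Vec ℤ q → Vec ℤ q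
wvec k x y = ΣvFrom1 k (λ ℓ → S (iter (k ∸ ℓ) Mv x) ·v iter (ℓ ∸ 1) Mv e) +v iter k Mv y

-- Closed form (with 1-based indices j = toℕ j0 + 1, i = toℕ i0 + 1):
--   (1/q) Σ_{j=1}^p x_j [C(q+p-j+k,k) - C(p-j+k,k)] + (1/q) Σ_{i=1}^q C(k+q-i,k) y_i
closedForm : ∀ {p q} .{{_ : NonZero q}} → ℕ → Vec ℤ p → Vec ℤ q → ℚ
closedForm {p} {q} k x y =
    (ΣFin p (λ j0 → lookup x j0 ℤ.*
        (+ ((q ℕ.+ (p ∸ suc (toℕ j0)) ℕ.+ k) C k) ℤ.- + (((p ∸ suc (toℕ j0)) ℕ.+ k) C k))) / q)
  ℚ.+ (ΣFin q (λ i0 → + ((k ℕ.+ (q ∸ suc (toℕ i0))) C k) ℤ.* lookup y i0) / q)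

toℚ : ℤ → ℚ
toℚ z = z / 1

-- membership x(y) ∈ S_n(R):  entries in [-R,R], p + q ≤ n  (q ≥ 1 given by NonZero q).
InS : ∀ {p q} → ℕ → ℚ → Vec ℤ p → Vec ℤ q → Set
InS {p} {q} n R x y =
  (∀ j → ℚ.- R ℚ.≤ toℚ (lookup x j) × toℚ (lookup x j) ℚ.≤ R)
  × (∀ i → ℚ.- R ℚ.≤ toℚ (lookup y i) × toℚ (lookup y i) ℚ.≤ R)
  × p ℕ.+ q ℕ.≤ n

module Submission where

open import Defs
open import Data.Nat using (ℕ; NonZero; _<_; _∸_)
open import Data.Integer using (ℤ)
open import Data.Rational using (ℚ; 0ℚ; _/_)
open import Data.Vec using (Vec)
open import Data.Product using (_×_)
open import Relation.Binary.PropositionalEquality using (_≡_)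

-- Proof of Lemma 11.  Write f = x(y) for the lasso sequence, p = |x|, q = |y|,
-- and w_k = Σ_{ℓ=1}^k S(M^{k-ℓ} x)·M^{ℓ-1} e + M^k y  (the vector  wvec k x y).
--
-- M is linear and  M(u ++ v) = M u ++ (S(u)·e + M v);  hence
--     w_{k+1} = S(M^k x)·e + M w_k  and  M^k(x ++ y) = M^k x ++ w_k.
-- (2) Binomial weights.  The suffix-sum operator Mᵀ is adjoint to M for the dot
--     product and (Mᵀ)^k e is a diagonal of Pascal's triangle, so
--     S(M^k v) = Σ_i C(k + m-1-i, k) v_i.  Applied to x ++ y and to x, this gives
--     the closed form of S(w_k) = S(M^k(x ++ y)) − S(M^k x).
-- (3) Lasso-shaped sequences.  If f lists u and then repeats w, and S(w) = 0,
--     then its partial sums M f list M u and then repeat S(u)·e + M w.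
-- (4) Cesàro averages.  For a lasso u(w) with |w| = q the discrepancy
--     q·(f₀ + … + f_{T-1}) − T·S(w) is eventually periodic, hence bounded, so the
--     averages converge to S(w)/q.  A convergent sequence has its limit as its
--     only liminf; so φ = 0 forces S(w) = 0.
-- The theorem: by induction on ℓ ≤ k, (3), (4) and the hypotheses φ^(ℓ) = 0 show
-- that M^ℓ f is the lasso M^ℓ x (w_ℓ); then (4) computes φ^(k) and (2) the closed form.

open import Data.Nat as ℕ using (zero; suc)
open import Data.Nat.DivMod using (_%_; m%n<n; m≡m%n+[m/n]*n; [m+n]%n≡m%n; m<n⇒m%n≡m)
import Data.Nat.DivMod as DivMod
import Data.Nat.Properties as ℕP
import Data.Nat.Tactic.RingSolver as ℕSolver
open import Data.Nat.Combinatorics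
  using (_C_; nCk+nC[k+1]≡[n+1]C[k+1]; nCk≡nC[n∸k]; nCn≡1)
open import Data.Nat.Combinatorics.Specification using (k>n⇒nCk≡0)
open import Data.Integer as ℤ using (+_; -[1+_]; 0ℤ; _+_; _*_; _-_; -_; ∣_∣; +≤+; -≤+)
import Data.Integer.Properties as ℤP
open import Data.Integer.Tactic.RingSolver using (solve-∀)
import Data.Rational as ℚ
open import Data.Rational using (mkℚ; toℚᵘ)
import Data.Rational.Properties as ℚP
open import Data.Rational.Solver using (module +-*-Solver)
open import Data.Rational.Unnormalised as ℚᵘ using (mkℚᵘ; *≤*; *≡*)
import Data.Rational.Unnormalised.Properties as ℚᵘP
open import Data.Vec using ([]; _∷_; lookup; map; replicate; _++_)
open import Data.Vec.Properties
  using (map-++; map-∘; map-cong; map-replicate; lookup-map; lookup-zipWith; lookup-replicate)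
open import Data.Vec.Relation.Binary.Pointwise.Inductive
  using (Pointwise-≡⇒≡; zipWith-assoc; zipWith-identityˡ; zipWith-identityʳ)
open import Data.Fin as Fin using (Fin; toℕ; fromℕ<)
import Data.Fin.Properties as FinP
open import Data.Product using (_,_; proj₁; proj₂; ∃)
open import Data.Empty using (⊥; ⊥-elim)
open import Function using (_∘_)
open import Relation.Binary.PropositionalEquality
  using (refl; sym; trans; cong; cong₂; subst; module ≡-Reasoning)
open import Relation.Nullary using (yes; no)
open import Relation.Binary.Definitions using (tri<; tri≈; tri>)

-- (1) Finite algebra

zeros : ∀ {n} → Vec ℤ n
zeros = replicate _ 0ℤ

+v-identityˡ : ∀ {n} (v : Vec ℤ n) → zeros +v v ≡ v
+v-identityˡ v = Pointwise-≡⇒≡ (zipWith-identityˡ ℤP.+-identityˡ v)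

+v-identityʳ : ∀ {n} (v : Vec ℤ n) → v +v zeros ≡ v
+v-identityʳ v = Pointwise-≡⇒≡ (zipWith-identityʳ ℤP.+-identityʳ v)

+v-assoc : ∀ {n} (u v w : Vec ℤ n) → (u +v v) +v w ≡ u +v (v +v w)
+v-assoc u v w = Pointwise-≡⇒≡ (zipWith-assoc ℤP.+-assoc u v w)

translate : ∀ {n} → ℤ → Vec ℤ n → Vec ℤ n
translate a = map (λ t → a + t)

translate-+v : ∀ {n} a b (u v : Vec ℤ n) → translate (a + b) (u +v v) ≡ translate a u +v translate b v
translate-+v a b [] [] = refl
translate-+v a b (c ∷ u) (d ∷ v) = cong₂ _∷_ (interchange a b c d) (translate-+v a b u v)
  where
  interchange : ∀ a b c d → (a + b) + (c + d) ≡ (a + c) + (b + d)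
  interchange = solve-∀

translate-·v : ∀ {n} c a (v : Vec ℤ n) → translate (c * a) (c ·v v) ≡ c ·v translate a v
translate-·v c a v = begin
    translate (c * a) (c ·v v)          ≡⟨ map-∘ (λ t → c * a + t) (c *_) v ⟨
    map (λ b → c * a + c * b) v         ≡⟨ map-cong (λ b → sym (ℤP.*-distribˡ-+ c a b)) v ⟩
    map (λ b → c * (a + b)) v           ≡⟨ map-∘ (c *_) (λ t → a + t) v ⟩
    c ·v translate a v                  ∎
  where open ≡-Reasoning

translate-·e : ∀ {n} a c (w : Vec ℤ n) → translate a ((c ·v e) +v w) ≡ ((a + c) ·v e) +v w
translate-·e a c [] = refl
translate-·e a c (b ∷ w) = cong₂ _∷_ (shift a c b) (translate-·e a c w)
  where
  shift : ∀ a c b → a + (c * + 1 + b) ≡ (a + c) * + 1 + b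
  shift = solve-∀

Mv-+v : ∀ {n} (u v : Vec ℤ n) → Mv (u +v v) ≡ Mv u +v Mv v
Mv-+v [] [] = refl
Mv-+v (a ∷ u) (b ∷ v) = cong ((a + b) ∷_) (begin
    translate (a + b) (Mv (u +v v))       ≡⟨ cong (translate (a + b)) (Mv-+v u v) ⟩
    translate (a + b) (Mv u +v Mv v)      ≡⟨ translate-+v a b (Mv u) (Mv v) ⟩
    translate a (Mv u) +v translate b (Mv v) ∎)
  where open ≡-Reasoning

Mv-·v : ∀ {n} c (v : Vec ℤ n) → Mv (c ·v v) ≡ c ·v Mv v
Mv-·v c [] = refl
Mv-·v c (a ∷ v) = cong ((c * a) ∷_) (begin
    translate (c * a) (Mv (c ·v v))       ≡⟨ cong (translate (c * a)) (Mv-·v c v) ⟩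
    translate (c * a) (c ·v Mv v)         ≡⟨ translate-·v c a (Mv v) ⟩
    c ·v translate a (Mv v)               ∎)
  where open ≡-Reasoning

Mv-zeros : ∀ {n} → Mv (zeros {n}) ≡ zeros
Mv-zeros {zero}  = refl
Mv-zeros {suc n} =
  cong (0ℤ ∷_) (trans (cong (translate 0ℤ) Mv-zeros) (map-replicate (λ t → 0ℤ + t) 0ℤ n))

Mv-++ : ∀ {m n} (u : Vec ℤ m) (v : Vec ℤ n) → Mv (u ++ v) ≡ Mv u ++ ((S u ·v e) +v Mv v)
Mv-++ [] v = sym (trans (cong (_+v Mv v) (map-replicate (0ℤ *_) (+ 1) _)) (+v-identityˡ (Mv v)))
Mv-++ (a ∷ u) v = cong (a ∷_) (begin
    translate a (Mv (u ++ v))                              ≡⟨ cong (translate a) (Mv-++ u v) ⟩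
    translate a (Mv u ++ ((S u ·v e) +v Mv v))             ≡⟨ map-++ (λ t → a + t) (Mv u) _ ⟩
    translate a (Mv u) ++ translate a ((S u ·v e) +v Mv v)
      ≡⟨ cong (translate a (Mv u) ++_) (translate-·e a (S u) (Mv v)) ⟩
    translate a (Mv u) ++ (((a + S u) ·v e) +v Mv v)       ∎)
  where open ≡-Reasoning

ΣvFrom1-cong : ∀ {q} k (f g : ℕ → Vec ℤ q) → (∀ ℓ → f (suc ℓ) ≡ g (suc ℓ)) →
  ΣvFrom1 k f ≡ ΣvFrom1 k g
ΣvFrom1-cong zero    f g f≗g = refl
ΣvFrom1-cong (suc k) f g f≗g = cong₂ _+v_ (ΣvFrom1-cong k f g f≗g) (f≗g k)

ΣvFrom1-first : ∀ {q} k (h : ℕ → Vec ℤ q) → ΣvFrom1 (suc k) h ≡ h 1 +v ΣvFrom1 k (h ∘ suc)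
ΣvFrom1-first zero    h = trans (+v-identityˡ (h 1)) (sym (+v-identityʳ (h 1)))
ΣvFrom1-first (suc k) h = trans (cong (_+v h (suc (suc k))) (ΣvFrom1-first k h))
  (+v-assoc (h 1) (ΣvFrom1 k (h ∘ suc)) (h (suc (suc k))))

Mv-ΣvFrom1 : ∀ {q} k (f : ℕ → Vec ℤ q) → Mv (ΣvFrom1 k f) ≡ ΣvFrom1 k (Mv ∘ f)
Mv-ΣvFrom1 zero    f = Mv-zeros
Mv-ΣvFrom1 (suc k) f = trans (Mv-+v (ΣvFrom1 k f) (f (suc k))) (cong (_+v Mv (f (suc k))) (Mv-ΣvFrom1 k f))

wvec-suc : ∀ {p q} k (x : Vec ℤ p) (y : Vec ℤ q) →
  wvec (suc k) x y ≡ (S (iter k Mv x) ·v e) +v Mv (wvec k x y)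
wvec-suc {p} {q} k x y = sym (begin
    (s ·v e) +v Mv (ΣvFrom1 k (term k) +v iter k Mv y)
  ≡⟨ cong ((s ·v e) +v_) (Mv-+v (ΣvFrom1 k (term k)) (iter k Mv y)) ⟩
    (s ·v e) +v (Mv (ΣvFrom1 k (term k)) +v iter (suc k) Mv y)
  ≡⟨ +v-assoc (s ·v e) _ _ ⟨
    ((s ·v e) +v Mv (ΣvFrom1 k (term k))) +v iter (suc k) Mv y
  ≡⟨ cong (λ z → ((s ·v e) +v z) +v iter (suc k) Mv y) Mv-terms ⟩
    ((s ·v e) +v ΣvFrom1 k (term (suc k) ∘ suc)) +v iter (suc k) Mv y
  ≡⟨ cong (_+v iter (suc k) Mv y) (ΣvFrom1-first k (term (suc k))) ⟨
    ΣvFrom1 (suc k) (term (suc k)) +v iter (suc k) Mv y ∎)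
  where
  open ≡-Reasoning
  s = S (iter k Mv x)
  term : ℕ → ℕ → Vec ℤ q
  term k ℓ = S (iter (k ∸ ℓ) Mv x) ·v iter (ℓ ∸ 1) Mv e
  -- Applying M to the k-th sum shifts its index: it becomes the tail of the (k+1)-th.
  Mv-terms : Mv (ΣvFrom1 k (term k)) ≡ ΣvFrom1 k (term (suc k) ∘ suc)
  Mv-terms = trans (Mv-ΣvFrom1 k (term k)) (ΣvFrom1-cong k (Mv ∘ term k) (term (suc k) ∘ suc)
    (λ ℓ → Mv-·v (S (iter (k ∸ suc ℓ) Mv x)) (iter ℓ Mv e)))

-- M^k(x ++ y) = M^k x ++ w_k : the first period of the formula for M^k(x(y)).
iter-Mv-++ : ∀ {p q} k (x : Vec ℤ p) (y : Vec ℤ q) → iter k Mv (x ++ y) ≡ iter k Mv x ++ wvec k x y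
iter-Mv-++ zero    x y = cong (x ++_) (sym (+v-identityˡ y))
iter-Mv-++ (suc k) x y = begin
    Mv (iter k Mv (x ++ y))
  ≡⟨ cong Mv (iter-Mv-++ k x y) ⟩
    Mv (iter k Mv x ++ wvec k x y)
  ≡⟨ Mv-++ (iter k Mv x) (wvec k x y) ⟩
    iter (suc k) Mv x ++ ((S (iter k Mv x) ·v e) +v Mv (wvec k x y))
  ≡⟨ cong (iter (suc k) Mv x ++_) (wvec-suc k x y) ⟨
    iter (suc k) Mv x ++ wvec (suc k) x y ∎
  where open ≡-Reasoning

-- (2) Binomial weights

dot : ∀ {n} → Vec ℤ n → Vec ℤ n → ℤ
dot {n} c v = ΣFin n (λ i → lookup c i * lookup v i)

ΣFin-cong : ∀ n (f g : Fin n → ℤ) → (∀ i → f i ≡ g i) → ΣFin n f ≡ ΣFin n g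
ΣFin-cong zero    f g f≗g = refl
ΣFin-cong (suc n) f g f≗g =
  cong₂ _+_ (f≗g Fin.zero) (ΣFin-cong n (f ∘ Fin.suc) (g ∘ Fin.suc) (f≗g ∘ Fin.suc))

dot-e : ∀ {n} (v : Vec ℤ n) → dot e v ≡ S v
dot-e []      = refl
dot-e (a ∷ v) = cong₂ _+_ (ℤP.*-identityˡ a) (dot-e v)

-- Suffix sums  (Mᵀ c)_i = c_i + c_{i+1} + … : the adjoint of M for the dot product.
Mᵀ : ∀ {n} → Vec ℤ n → Vec ℤ n
Mᵀ []       = []
Mᵀ (c ∷ cs) = (c + S cs) ∷ Mᵀ cs

dot-translate : ∀ {n} a (c v : Vec ℤ n) →
  ΣFin n (λ i → lookup c i * (a + lookup v i)) ≡ a * S c + dot c v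
dot-translate a [] [] = sym (trans (ℤP.+-identityʳ (a * 0ℤ)) (ℤP.*-zeroʳ a))
dot-translate a (d ∷ c) (b ∷ v) =
  trans (cong (λ z → d * (a + b) + z) (dot-translate a c v)) (regroup a b d (S c) (dot c v))
  where
  regroup : ∀ a b d s t → d * (a + b) + (a * s + t) ≡ a * (d + s) + (d * b + t)
  regroup = solve-∀

dot-Mv : ∀ {n} (c v : Vec ℤ n) → dot c (Mv v) ≡ dot (Mᵀ c) v
dot-Mv [] [] = refl
dot-Mv (d ∷ c) (a ∷ v) = begin
    d * a + ΣFin _ (λ i → lookup c i * lookup (translate a (Mv v)) i)
  ≡⟨ cong (λ z → d * a + z) (ΣFin-cong _ _ _ (λ i → cong (lookup c i *_) (lookup-map i (λ t → a + t) (Mv v)))) ⟩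
    d * a + ΣFin _ (λ i → lookup c i * (a + lookup (Mv v) i))
  ≡⟨ cong (λ z → d * a + z) (dot-translate a c (Mv v)) ⟩
    d * a + (a * S c + dot c (Mv v))
  ≡⟨ cong (λ z → d * a + (a * S c + z)) (dot-Mv c v) ⟩
    d * a + (a * S c + dot (Mᵀ c) v)
  ≡⟨ regroup d a (S c) (dot (Mᵀ c) v) ⟩
    (d + S c) * a + dot (Mᵀ c) v ∎
  where
  open ≡-Reasoning
  regroup : ∀ d a s t → d * a + (a * s + t) ≡ (d + s) * a + t
  regroup = solve-∀

iter-comm : ∀ {A : Set} k (f : A → A) a → iter k f (f a) ≡ f (iter k f a)
iter-comm zero    f a = refl
iter-comm (suc k) f a = cong f (iter-comm k f a)

dot-iter-Mv : ∀ {n} k (c v : Vec ℤ n) → dot c (iter k Mv v) ≡ dot (iter k Mᵀ c) v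
dot-iter-Mv zero    c v = refl
dot-iter-Mv (suc k) c v = begin
    dot c (Mv (iter k Mv v))   ≡⟨ dot-Mv c (iter k Mv v) ⟩
    dot (Mᵀ c) (iter k Mv v)   ≡⟨ dot-iter-Mv k (Mᵀ c) v ⟩
    dot (iter k Mᵀ (Mᵀ c)) v   ≡⟨ cong (λ z → dot z v) (iter-comm k Mᵀ c) ⟩
    dot (Mᵀ (iter k Mᵀ c)) v   ∎
  where open ≡-Reasoning

pascal : ∀ n k → + (n C k) + + (n C suc k) ≡ + (suc n C suc k)
pascal n k = cong +_ (nCk+nC[k+1]≡[n+1]C[k+1] n k)

S-[] : (v : Vec ℤ 0) → S v ≡ 0ℤ
S-[] [] = refl

-- (Mᵀ)^k e is a diagonal of Pascal's triangle: its head is C(k+m, k) and its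
-- entries sum to C(k+m, k+1).  The two facts are proved by simultaneous induction.
mutual
  iter-Mᵀ-e : ∀ k m → iter k Mᵀ (e {suc m}) ≡ + ((k ℕ.+ m) C k) ∷ iter k Mᵀ (e {m})
  iter-Mᵀ-e zero    m = cong (λ z → + z ∷ e) (sym (trans (nCk≡nC[n∸k] {0} {m} ℕ.z≤n) (nCn≡1 m)))
  iter-Mᵀ-e (suc k) m = trans (cong Mᵀ (iter-Mᵀ-e k m)) (cong (_∷ Mᵀ (iter k Mᵀ e))
    (trans (cong (λ z → + ((k ℕ.+ m) C k) + z) (S-iter-Mᵀ-e k m)) (pascal (k ℕ.+ m) k)))

  S-iter-Mᵀ-e : ∀ k m → S (iter k Mᵀ (e {m})) ≡ + ((k ℕ.+ m) C suc k)
  S-iter-Mᵀ-e k zero = trans (S-[] (iter k Mᵀ e)) (cong +_ (sym (k>n⇒nCk≡0 k+0<1+k)))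
    where
    k+0<1+k : k ℕ.+ 0 ℕ.< suc k
    k+0<1+k = subst (ℕ._< suc k) (sym (ℕP.+-identityʳ k)) (ℕP.n<1+n k)
  S-iter-Mᵀ-e k (suc m) = begin
      S (iter k Mᵀ (e {suc m}))                     ≡⟨ cong S (iter-Mᵀ-e k m) ⟩
      + ((k ℕ.+ m) C k) + S (iter k Mᵀ (e {m}))     ≡⟨ cong (λ z → + ((k ℕ.+ m) C k) + z) (S-iter-Mᵀ-e k m) ⟩
      + ((k ℕ.+ m) C k) + + ((k ℕ.+ m) C suc k)     ≡⟨ pascal (k ℕ.+ m) k ⟩
      + (suc (k ℕ.+ m) C suc k)                     ≡⟨ cong (λ z → + (z C suc k)) (ℕP.+-suc k m) ⟨
      + ((k ℕ.+ suc m) C suc k)                     ∎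
    where open ≡-Reasoning

lookup-iter-Mᵀ-e : ∀ k m (i : Fin m) → lookup (iter k Mᵀ (e {m})) i ≡ + ((k ℕ.+ (m ∸ suc (toℕ i))) C k)
lookup-iter-Mᵀ-e k (suc m) Fin.zero    = cong (λ v → lookup v Fin.zero) (iter-Mᵀ-e k m)
lookup-iter-Mᵀ-e k (suc m) (Fin.suc i) =
  trans (cong (λ v → lookup v (Fin.suc i)) (iter-Mᵀ-e k m)) (lookup-iter-Mᵀ-e k m i)

S-iter-Mv : ∀ {m} k (v : Vec ℤ m) → S (iter k Mv v) ≡ ΣFin m (λ i → + ((k ℕ.+ (m ∸ suc (toℕ i))) C k) * lookup v i)
S-iter-Mv {m} k v = begin
    S (iter k Mv v)          ≡⟨ dot-e (iter k Mv v) ⟨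
    dot e (iter k Mv v)      ≡⟨ dot-iter-Mv k e v ⟩
    dot (iter k Mᵀ e) v      ≡⟨ ΣFin-cong m _ _ (λ i → cong (_* lookup v i) (lookup-iter-Mᵀ-e k m i)) ⟩
    ΣFin m (λ i → + ((k ℕ.+ (m ∸ suc (toℕ i))) C k) * lookup v i) ∎
  where open ≡-Reasoning

ΣFin-++ : ∀ {p q} (g : ℕ → ℤ) (x : Vec ℤ p) (y : Vec ℤ q) →
  ΣFin (p ℕ.+ q) (λ i → g ((p ℕ.+ q) ∸ suc (toℕ i)) * lookup (x ++ y) i)
  ≡ ΣFin p (λ j → g (q ℕ.+ (p ∸ suc (toℕ j))) * lookup x j) + ΣFin q (λ i → g (q ∸ suc (toℕ i)) * lookup y i)
ΣFin-++ g [] y = sym (ℤP.+-identityˡ _)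
ΣFin-++ {suc p} {q} g (a ∷ x) y =
  trans (cong₂ _+_ (cong (λ z → g z * a) (ℕP.+-comm p q)) (ΣFin-++ g x y))
        (sym (ℤP.+-assoc (g (q ℕ.+ p) * a) _ _))

ΣFin-*-sub : ∀ n (f g h : Fin n → ℤ) →
  ΣFin n (λ j → h j * (f j - g j)) ≡ ΣFin n (λ j → f j * h j) - ΣFin n (λ j → g j * h j)
ΣFin-*-sub zero    f g h = refl
ΣFin-*-sub (suc n) f g h =
  trans (cong (λ z → h Fin.zero * (f Fin.zero - g Fin.zero) + z)
               (ΣFin-*-sub n (f ∘ Fin.suc) (g ∘ Fin.suc) (h ∘ Fin.suc)))
        (regroup (h Fin.zero) (f Fin.zero) (g Fin.zero) _ _)
  where
  regroup : ∀ h f g a b → h * (f - g) + (a - b) ≡ (f * h + a) - (g * h + b)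
  regroup = solve-∀

S-++ : ∀ {m n} (u : Vec ℤ m) (v : Vec ℤ n) → S (u ++ v) ≡ S u + S v
S-++ []      v = sym (ℤP.+-identityˡ (S v))
S-++ (a ∷ u) v = trans (cong (λ z → a + z) (S-++ u v)) (sym (ℤP.+-assoc a (S u) (S v)))

-- The closed form of S(w_k):  since S(w_k) = S(M^k(x ++ y)) − S(M^k x),
-- it is the difference of two instances of the binomial formula.
S-wvec : ∀ {p q} k (x : Vec ℤ p) (y : Vec ℤ q) →
  S (wvec k x y) ≡
    ΣFin p (λ j → lookup x j *
        (+ ((q ℕ.+ (p ∸ suc (toℕ j)) ℕ.+ k) C k) - + (((p ∸ suc (toℕ j)) ℕ.+ k) C k)))
  + ΣFin q (λ i → + ((k ℕ.+ (q ∸ suc (toℕ i))) C k) * lookup y i)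
S-wvec {p} {q} k x y = begin
    S w
  ≡⟨ add-sub (S (iter k Mv x)) (S w) ⟩
    (S (iter k Mv x) + S w) - S (iter k Mv x)
  ≡⟨ cong₂ _-_ (sym (trans (cong S (iter-Mv-++ k x y)) (S-++ (iter k Mv x) w))) (S-iter-Mv k x) ⟩
    S (iter k Mv (x ++ y)) - B
  ≡⟨ cong (_- B) (trans (S-iter-Mv k (x ++ y)) (ΣFin-++ g x y)) ⟩
    (A + Y) - B
  ≡⟨ swap A Y B ⟩
    (A - B) + Y
  ≡⟨ cong (_+ Y) (sym (trans (ΣFin-*-sub p G₁ G₂ (lookup x)) (cong₂ _-_ (reorder a₁) (reorder a₂)))) ⟩
    ΣFin p (λ j → lookup x j * (G₁ j - G₂ j)) + Y ∎
  where
  open ≡-Reasoning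
  w = wvec k x y
  -- a₁ j, a₂ j: the number of entries after x_j in x ++ y and in x;
  -- g a: the weight of an entry followed by a entries.
  a₁ a₂ : Fin p → ℕ
  a₁ j = q ℕ.+ (p ∸ suc (toℕ j))
  a₂ j = p ∸ suc (toℕ j)
  g : ℕ → ℤ
  g n = + ((k ℕ.+ n) C k)
  A = ΣFin p (λ j → g (a₁ j) * lookup x j)
  B = ΣFin p (λ j → g (a₂ j) * lookup x j)
  Y = ΣFin q (λ i → g (q ∸ suc (toℕ i)) * lookup y i)
  G₁ G₂ : Fin p → ℤ
  G₁ j = + ((a₁ j ℕ.+ k) C k)
  G₂ j = + ((a₂ j ℕ.+ k) C k)
  reorder : ∀ (a : Fin p → ℕ) →
    ΣFin p (λ j → + ((a j ℕ.+ k) C k) * lookup x j) ≡ ΣFin p (λ j → g (a j) * lookup x j)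
  reorder a = ΣFin-cong p _ _ (λ j → cong (λ z → + (z C k) * lookup x j) (ℕP.+-comm (a j) k))
  add-sub : ∀ a b → b ≡ (a + b) - a
  add-sub = solve-∀
  swap : ∀ a y b → (a + y) - b ≡ (a - b) + y
  swap = solve-∀

-- (3) Lasso-shaped sequences

EventuallyPeriodic : ∀ {A : Set} → ℕ → ℕ → (ℕ → A) → Set
EventuallyPeriodic p q h = ∀ n → h (p ℕ.+ n ℕ.+ q) ≡ h (p ℕ.+ n)

periodic-mod : ∀ {A : Set} p q .{{_ : NonZero q}} (h : ℕ → A) → EventuallyPeriodic p q h →
  ∀ n → h (p ℕ.+ n) ≡ h (p ℕ.+ n % q)
periodic-mod p q h periodic n =
  trans (cong (λ z → h (p ℕ.+ z)) (m≡m%n+[m/n]*n n q)) (drop-periods (n DivMod./ q) (n % q))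
  where
  drop-periods : ∀ t r → h (p ℕ.+ (r ℕ.+ t ℕ.* q)) ≡ h (p ℕ.+ r)
  drop-periods zero    r = cong (λ z → h (p ℕ.+ z)) (ℕP.+-identityʳ r)
  drop-periods (suc t) r = trans (cong h (regroup p q t r))
    (trans (periodic (r ℕ.+ t ℕ.* q)) (drop-periods t r))
    where
    regroup : ∀ p q t r → p ℕ.+ (r ℕ.+ (q ℕ.+ t ℕ.* q)) ≡ p ℕ.+ (r ℕ.+ t ℕ.* q) ℕ.+ q
    regroup = ℕSolver.solve-∀

record IsLasso {p q} (u : Vec ℤ p) (w : Vec ℤ q) (f : ℕ → ℤ) : Set where
  field
    stem     : ∀ (j : Fin p) → f (toℕ j) ≡ lookup u j
    loop     : ∀ (r : Fin q) → f (p ℕ.+ toℕ r) ≡ lookup w r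
    periodic : EventuallyPeriodic p q f
open IsLasso

lookup-fromℕ<-cong : ∀ {q} (w : Vec ℤ q) {a b} .(a<q : a ℕ.< q) .(b<q : b ℕ.< q) → a ≡ b →
  lookup w (fromℕ< a<q) ≡ lookup w (fromℕ< b<q)
lookup-fromℕ<-cong w a<q b<q a≡b = cong (lookup w) (FinP.fromℕ<-cong _ _ a≡b a<q b<q)

lasso-isLasso : ∀ {p q} .{{_ : NonZero q}} (u : Vec ℤ p) (w : Vec ℤ q) → IsLasso u w (lasso u w)
lasso-isLasso {p} {q} u w = record { stem = stem′ ; loop = loop′ ; periodic = periodic′ }
  where
  stem′ : ∀ (j : Fin p) → lasso u w (toℕ j) ≡ lookup u j
  stem′ j with toℕ j ℕ.<? p
  ... | yes j<p = cong (lookup u) (FinP.fromℕ<-toℕ j j<p)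
  ... | no  j≮p = ⊥-elim (j≮p (FinP.toℕ<n j))
  loop′ : ∀ (r : Fin q) → lasso u w (p ℕ.+ toℕ r) ≡ lookup w r
  loop′ r with p ℕ.+ toℕ r ℕ.<? p
  ... | yes p+r<p = ⊥-elim (ℕP.m+n≮m p (toℕ r) p+r<p)
  ... | no  _     = trans
    (lookup-fromℕ<-cong w _ (FinP.toℕ<n r)
      (trans (cong (_% q) (ℕP.m+n∸m≡n p (toℕ r))) (m<n⇒m%n≡m (FinP.toℕ<n r))))
    (cong (lookup w) (FinP.fromℕ<-toℕ r _))
  periodic′ : EventuallyPeriodic p q (lasso u w)
  periodic′ n with p ℕ.+ n ℕ.+ q ℕ.<? p | p ℕ.+ n ℕ.<? p
  ... | yes lt | _      = ⊥-elim (ℕP.m+n≮m p (n ℕ.+ q) (subst (ℕ._< p) (ℕP.+-assoc p n q) lt))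
  ... | no _   | yes lt = ⊥-elim (ℕP.m+n≮m p n lt)
  ... | no _   | no _   = lookup-fromℕ<-cong w _ _ (begin
      (p ℕ.+ n ℕ.+ q ∸ p) % q   ≡⟨ cong (λ z → (z ∸ p) % q) (ℕP.+-assoc p n q) ⟩
      (p ℕ.+ (n ℕ.+ q) ∸ p) % q ≡⟨ cong (_% q) (ℕP.m+n∸m≡n p (n ℕ.+ q)) ⟩
      (n ℕ.+ q) % q             ≡⟨ [m+n]%n≡m%n n q ⟩
      n % q                     ≡⟨ cong (_% q) (ℕP.m+n∸m≡n p n) ⟨
      (p ℕ.+ n ∸ p) % q         ∎)
    where open ≡-Reasoning

isLasso-unique : ∀ {p q} .{{_ : NonZero q}} {u : Vec ℤ p} {w : Vec ℤ q} {f g : ℕ → ℤ} →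
  IsLasso u w f → IsLasso u w g → ∀ i → f i ≡ g i
isLasso-unique {p} {q} {u} {w} {f} {g} Lf Lg i with i ℕ.<? p
... | yes i<p = begin
    f i                      ≡⟨ cong f (FinP.toℕ-fromℕ< i<p) ⟨
    f (toℕ (fromℕ< i<p))     ≡⟨ trans (stem Lf _) (sym (stem Lg _)) ⟩
    g (toℕ (fromℕ< i<p))     ≡⟨ cong g (FinP.toℕ-fromℕ< i<p) ⟩
    g i                      ∎
  where open ≡-Reasoning
... | no i≮p = begin
    f i                      ≡⟨ cong f p+[i∸p]≡i ⟨
    f (p ℕ.+ (i ∸ p))        ≡⟨ in-loop Lf (i ∸ p) ⟩
    lookup w (fromℕ< _)      ≡⟨ in-loop Lg (i ∸ p) ⟨
    g (p ℕ.+ (i ∸ p))        ≡⟨ cong g p+[i∸p]≡i ⟩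
    g i                      ∎
  where
  open ≡-Reasoning
  p+[i∸p]≡i : p ℕ.+ (i ∸ p) ≡ i
  p+[i∸p]≡i = ℕP.m+[n∸m]≡n (ℕP.≮⇒≥ i≮p)
  in-loop : ∀ {h} → IsLasso u w h → ∀ n → h (p ℕ.+ n) ≡ lookup w (fromℕ< (m%n<n n q))
  in-loop {h} L n = trans (periodic-mod p q h (periodic L) n)
    (trans (cong (λ z → h (p ℕ.+ z)) (sym (FinP.toℕ-fromℕ< (m%n<n n q)))) (loop L _))

sumUpTo-suc : ∀ (f : ℕ → ℤ) n → sumUpTo f (suc n) ≡ f 0 + sumUpTo (f ∘ suc) n
sumUpTo-suc f zero    = trans (ℤP.+-identityˡ (f 0)) (sym (ℤP.+-identityʳ (f 0)))
sumUpTo-suc f (suc n) = trans (cong (_+ f (suc n)) (sumUpTo-suc f n)) (ℤP.+-assoc (f 0) _ _)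

sumUpTo-+ : ∀ (f : ℕ → ℤ) m n → sumUpTo f (m ℕ.+ n) ≡ sumUpTo f m + sumUpTo (λ t → f (m ℕ.+ t)) n
sumUpTo-+ f m zero    = trans (cong (sumUpTo f) (ℕP.+-identityʳ m)) (sym (ℤP.+-identityʳ _))
sumUpTo-+ f m (suc n) = trans (cong (sumUpTo f) (ℕP.+-suc m n))
  (trans (cong (_+ f (m ℕ.+ n)) (sumUpTo-+ f m n)) (ℤP.+-assoc (sumUpTo f m) _ _))

sumUpTo-S : ∀ {m} (v : Vec ℤ m) (g : ℕ → ℤ) → (∀ j → g (toℕ j) ≡ lookup v j) → sumUpTo g m ≡ S v
sumUpTo-S []      g g≗v = refl
sumUpTo-S {suc m} (a ∷ v) g g≗v =
  trans (sumUpTo-suc g m) (cong₂ _+_ (g≗v Fin.zero) (sumUpTo-S v (g ∘ suc) (g≗v ∘ Fin.suc)))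

sumUpTo-Mv : ∀ {m} (v : Vec ℤ m) (g : ℕ → ℤ) → (∀ j → g (toℕ j) ≡ lookup v j) →
  ∀ j → sumUpTo g (suc (toℕ j)) ≡ lookup (Mv v) j
sumUpTo-Mv (a ∷ v) g g≗v Fin.zero    = trans (ℤP.+-identityˡ (g 0)) (g≗v Fin.zero)
sumUpTo-Mv (a ∷ v) g g≗v (Fin.suc j) = trans (sumUpTo-suc g (suc (toℕ j)))
  (trans (cong₂ _+_ (g≗v Fin.zero) (sumUpTo-Mv v (g ∘ suc) (g≗v ∘ Fin.suc) j))
         (sym (lookup-map j (λ t → a + t) (Mv v))))

sumUpTo-period : ∀ {p q} {u : Vec ℤ p} {w : Vec ℤ q} {f} → IsLasso u w f →
  ∀ n → sumUpTo f (p ℕ.+ n ℕ.+ q) ≡ sumUpTo f (p ℕ.+ n) + S w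
sumUpTo-period {p} {q} {u} {w} {f} L zero = begin
    sumUpTo f (p ℕ.+ 0 ℕ.+ q)                         ≡⟨ cong (λ z → sumUpTo f (z ℕ.+ q)) (ℕP.+-identityʳ p) ⟩
    sumUpTo f (p ℕ.+ q)                               ≡⟨ sumUpTo-+ f p q ⟩
    sumUpTo f p + sumUpTo (λ t → f (p ℕ.+ t)) q       ≡⟨ cong₂ _+_ (cong (sumUpTo f) (sym (ℕP.+-identityʳ p)))
                                                                   (sumUpTo-S w (λ t → f (p ℕ.+ t)) (loop L)) ⟩
    sumUpTo f (p ℕ.+ 0) + S w                         ∎
  where open ≡-Reasoning
sumUpTo-period {p} {q} {u} {w} {f} L (suc n) = begin
    sumUpTo f (p ℕ.+ suc n ℕ.+ q)                     ≡⟨ cong (sumUpTo f) (regroup p n q) ⟩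
    sumUpTo f (p ℕ.+ n ℕ.+ q) + f (p ℕ.+ n ℕ.+ q)     ≡⟨ cong₂ _+_ (sumUpTo-period L n) (periodic L n) ⟩
    (sumUpTo f (p ℕ.+ n) + S w) + f (p ℕ.+ n)         ≡⟨ swap (sumUpTo f (p ℕ.+ n)) (S w) (f (p ℕ.+ n)) ⟩
    (sumUpTo f (p ℕ.+ n) + f (p ℕ.+ n)) + S w         ≡⟨ cong (λ z → sumUpTo f z + S w) (ℕP.+-suc p n) ⟨
    sumUpTo f (p ℕ.+ suc n) + S w                     ∎
  where
  open ≡-Reasoning
  regroup : ∀ p n q → p ℕ.+ suc n ℕ.+ q ≡ suc (p ℕ.+ n ℕ.+ q)
  regroup = ℕSolver.solve-∀
  swap : ∀ a b c → (a + b) + c ≡ (a + c) + b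
  swap = solve-∀

Ms-isLasso : ∀ {p q} {u : Vec ℤ p} {w : Vec ℤ q} {f} → IsLasso u w f → S w ≡ 0ℤ →
  IsLasso (Mv u) ((S u ·v e) +v Mv w) (Ms f)
Ms-isLasso {p} {q} {u} {w} {f} L Sw≡0 = record { stem = stem′ ; loop = loop′ ; periodic = periodic′ }
  where
  stem′ : ∀ j → Ms f (toℕ j) ≡ lookup (Mv u) j
  stem′ = sumUpTo-Mv u f (stem L)
  loop′ : ∀ r → Ms f (p ℕ.+ toℕ r) ≡ lookup ((S u ·v e) +v Mv w) r
  loop′ r = begin
      sumUpTo f (suc (p ℕ.+ toℕ r))                             ≡⟨ cong (sumUpTo f) (ℕP.+-suc p (toℕ r)) ⟨
      sumUpTo f (p ℕ.+ suc (toℕ r))                             ≡⟨ sumUpTo-+ f p (suc (toℕ r)) ⟩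
      sumUpTo f p + sumUpTo (λ t → f (p ℕ.+ t)) (suc (toℕ r))   ≡⟨ cong₂ _+_ (sumUpTo-S u f (stem L))
                                                                      (sumUpTo-Mv w (λ t → f (p ℕ.+ t)) (loop L) r) ⟩
      S u + lookup (Mv w) r                                     ≡⟨ cong (_+ lookup (Mv w) r) lookup-S·e ⟨
      lookup (S u ·v e) r + lookup (Mv w) r                     ≡⟨ lookup-zipWith _+_ r (S u ·v e) (Mv w) ⟨
      lookup ((S u ·v e) +v Mv w) r                             ∎
    where
    open ≡-Reasoning
    lookup-S·e : lookup (S u ·v e) r ≡ S u
    lookup-S·e = trans (lookup-map r (S u *_) e)
      (trans (cong (S u *_) (lookup-replicate r (+ 1))) (ℤP.*-identityʳ (S u)))
  periodic′ : EventuallyPeriodic p q (Ms f)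
  periodic′ n = cong₂ _+_
    (trans (sumUpTo-period L n)
      (trans (cong (λ z → sumUpTo f (p ℕ.+ n) + z) Sw≡0) (ℤP.+-identityʳ (sumUpTo f (p ℕ.+ n)))))
    (periodic L n)

-- (4) Cesàro averages

sumBelow : (ℕ → ℕ) → ℕ → ℕ
sumBelow h zero    = 0
sumBelow h (suc N) = sumBelow h N ℕ.+ h N

≤-sumBelow : ∀ h N T → T ℕ.< N → h T ℕ.≤ sumBelow h N
≤-sumBelow h (suc N) T T<1+N with T ℕ.≟ N
... | yes refl = ℕP.m≤n+m (h T) (sumBelow h N)
... | no  T≢N  = ℕP.≤-trans (≤-sumBelow h N T (ℕP.≤∧≢⇒< (ℕP.≤-pred T<1+N) T≢N))
                            (ℕP.m≤m+n (sumBelow h N) (h N))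

periodic-bounded : ∀ p q .{{_ : NonZero q}} (h : ℕ → ℕ) → EventuallyPeriodic p q h →
  ∀ T → h T ℕ.≤ sumBelow h (p ℕ.+ q)
periodic-bounded p q h periodic T with T ℕ.<? p ℕ.+ q
... | yes T<p+q = ≤-sumBelow h (p ℕ.+ q) T T<p+q
... | no  T≮p+q = subst (λ z → h z ℕ.≤ sumBelow h (p ℕ.+ q)) p+[T∸p]≡T
  (subst (ℕ._≤ sumBelow h (p ℕ.+ q)) (sym (periodic-mod p q h periodic (T ∸ p)))
    (≤-sumBelow h (p ℕ.+ q) _ (ℕP.+-monoʳ-< p (m%n<n (T ∸ p) q))))
  where
  p+[T∸p]≡T : p ℕ.+ (T ∸ p) ≡ T
  p+[T∸p]≡T = ℕP.m+[n∸m]≡n (ℕP.≤-trans (ℕP.m≤m+n p q) (ℕP.≮⇒≥ T≮p+q))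

abs-bounds : ∀ (x : ℤ) B → ∣ x ∣ ℕ.≤ B → (- + B ℤ.≤ x) × (x ℤ.≤ + B)
abs-bounds (+ n)    B ∣x∣≤B = ℤP.neg-≤-pos , +≤+ ∣x∣≤B
abs-bounds -[1+ n ] B ∣x∣≤B = ℤP.neg-mono-≤ (+≤+ ∣x∣≤B) , -≤+

fraction-≤ : ∀ {x y : ℚ} {a c : ℤ} {b d : ℕ} → toℚᵘ x ℚᵘ.≃ mkℚᵘ a b → toℚᵘ y ℚᵘ.≃ mkℚᵘ c d →
  a * + suc d ℤ.≤ c * + suc b → x ℚ.≤ y
fraction-≤ x≃ y≃ ad≤cb =
  ℚP.toℚᵘ-cancel-≤ (ℚᵘP.≤-respˡ-≃ (ℚᵘP.≃-sym x≃) (ℚᵘP.≤-respʳ-≃ (ℚᵘP.≃-sym y≃) (*≤* ad≤cb)))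

toℚᵘ-/ : ∀ z n → toℚᵘ (z / suc n) ℚᵘ.≃ mkℚᵘ z n
toℚᵘ-/ z n = ℚP.toℚᵘ-fromℚᵘ (mkℚᵘ z n)

/≡0ℚ⇒≡0ℤ : ∀ z n → z / suc n ≡ 0ℚ → z ≡ 0ℤ
/≡0ℚ⇒≡0ℤ z n z/n≡0 with ℚᵘP.≃-trans (ℚᵘP.≃-sym (toℚᵘ-/ z n)) (ℚᵘP.≃-reflexive (cong toℚᵘ z/n≡0))
... | *≡* z*1≡0 = trans (sym (ℤP.*-identityʳ z)) z*1≡0

≤-by-difference : ∀ {a b} t → b - a ≡ t → 0ℤ ℤ.≤ t → a ℤ.≤ b
≤-by-difference t b-a≡t 0≤t = ℤP.0≤i-j⇒j≤i (subst (0ℤ ℤ.≤_) (sym b-a≡t) 0≤t)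

-- Integer form of  W/Q − k/D ≤ s/m  and  s/m ≤ W/Q + k/D, given that the
-- discrepancy X = Q·s − m·W is within B of 0 and B·D ≤ k·Q·m.
sandwich-lower : ∀ (W s B k Q m : ℤ) (d : ℕ) → - B ℤ.≤ Q * s - m * W → B * + d ℤ.≤ k * Q * m →
  (W * + d + (- k) * Q) * m ℤ.≤ s * (Q * + d)
sandwich-lower W s B k Q m d X≥-B Bd≤kQm =
  ≤-by-difference (((Q * s - m * W) - - B) * + d + (k * Q * m - B * + d)) (identity W s B k Q m (+ d))
    (ℤP.+-mono-≤ (ℤP.*-monoʳ-≤-nonNeg (+ d) (ℤP.i≤j⇒0≤j-i X≥-B)) (ℤP.i≤j⇒0≤j-i Bd≤kQm))
  where
  identity : ∀ W s B k Q m D →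
    s * (Q * D) - (W * D + (- k) * Q) * m ≡ ((Q * s - m * W) - - B) * D + (k * Q * m - B * D)
  identity = solve-∀

sandwich-upper : ∀ (W s B k Q m : ℤ) (d : ℕ) → Q * s - m * W ℤ.≤ B → B * + d ℤ.≤ k * Q * m →
  s * (Q * + d) ℤ.≤ (W * + d + k * Q) * m
sandwich-upper W s B k Q m d X≤B Bd≤kQm =
  ≤-by-difference ((B - (Q * s - m * W)) * + d + (k * Q * m - B * + d)) (identity W s B k Q m (+ d))
    (ℤP.+-mono-≤ (ℤP.*-monoʳ-≤-nonNeg (+ d) (ℤP.i≤j⇒0≤j-i X≤B)) (ℤP.i≤j⇒0≤j-i Bd≤kQm))
  where
  identity : ∀ W s B k Q m D →
    (W * D + k * Q) * m - s * (Q * D) ≡ (B - (Q * s - m * W)) * D + (k * Q * m - B * D)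
  identity = solve-∀

Converges : (ℕ → ℚ) → ℚ → Set
Converges a c = ∀ ε → ℚ.Positive ε → ∃ λ N → ∀ T → N ℕ.≤ T → (c ℚ.- ε ℚ.≤ a T) × (a T ℚ.≤ c ℚ.+ ε)

converges⇒liminf : ∀ {a c} → Converges a c → IsLiminf a c
converges⇒liminf conv =
    (λ ε ε>0 → proj₁ (conv ε ε>0) , λ T N≤T → proj₁ (proj₂ (conv ε ε>0) T N≤T))
  , (λ ε ε>0 N → let (N′ , close) = conv ε ε>0 in
       N ℕ.+ N′ , ℕP.m≤m+n N N′ , proj₂ (close (N ℕ.+ N′) (ℕP.m≤n+m N′ N)))

difference-positive : ∀ {x y} → x ℚ.< y → ℚ.Positive (y ℚ.- x)
difference-positive {x} {y} x<y =
  ℚ.positive (subst (ℚ._< y ℚ.- x) (ℚP.+-inverseʳ x) (ℚP.+-monoˡ-< (ℚ.- x) x<y))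

-- When c < d, no sequence is (for every ε > 0) frequently ≤ c + ε and eventually ≥ d − ε:
-- choosing c < m₁ < m₂ < d would put some a T between m₂ and m₁.
no-gap : ∀ {a : ℕ → ℚ} {c d : ℚ} → c ℚ.< d →
  (∀ ε → ℚ.Positive ε → ∀ N → ∃ λ T → N ℕ.≤ T × a T ℚ.≤ c ℚ.+ ε) →
  (∀ ε → ℚ.Positive ε → ∃ λ N → ∀ T → N ℕ.≤ T → d ℚ.- ε ℚ.≤ a T) → ⊥
no-gap {a} {c} {d} c<d frequently-below eventually-above with ℚP.<-dense c<d
... | m₁ , c<m₁ , m₁<d with ℚP.<-dense m₁<d
... | m₂ , m₁<m₂ , m₂<d = ℚP.<-irrefl refl (ℚP.<-≤-trans m₁<m₂ m₂≤m₁)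
  where
  open +-*-Solver
  above = eventually-above (d ℚ.- m₂) (difference-positive m₂<d)
  below = frequently-below (m₁ ℚ.- c) (difference-positive c<m₁) (proj₁ above)
  T = proj₁ below
  m₂≤m₁ : m₂ ℚ.≤ m₁
  m₂≤m₁ = begin
      m₂                  ≡⟨ solve 2 (λ d m → m := d :- (d :- m)) refl d m₂ ⟩
      d ℚ.- (d ℚ.- m₂)    ≤⟨ proj₂ above T (proj₁ (proj₂ below)) ⟩
      a T                 ≤⟨ proj₂ (proj₂ below) ⟩
      c ℚ.+ (m₁ ℚ.- c)    ≡⟨ solve 2 (λ c m → c :+ (m :- c) := m) refl c m₁ ⟩
      m₁                  ∎
    where open ℚP.≤-Reasoning

limit-unique-liminf : ∀ {a c c′} → Converges a c → IsLiminf a c′ → c ≡ c′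
limit-unique-liminf {a} {c} {c′} conv (eventually-above′ , frequently-below′) with ℚP.<-cmp c c′
... | tri< c<c′ _ _ = ⊥-elim (no-gap c<c′ (proj₂ (converges⇒liminf {a} {c} conv)) eventually-above′)
... | tri≈ _ c≡c′ _ = c≡c′
... | tri> _ _ c′<c = ⊥-elim (no-gap c′<c frequently-below′ (proj₁ (converges⇒liminf {a} {c} conv)))

bounded-discrepancy⇒converges : ∀ (f : ℕ → ℤ) (W : ℤ) q′ B →
  (∀ T → (- + B ℤ.≤ + suc q′ * sumUpTo f T - + T * W) × (+ suc q′ * sumUpTo f T - + T * W ℤ.≤ + B)) →
  Converges (avg f) (W / suc q′)
bounded-discrepancy⇒converges f W q′ B bounded (mkℚ (+ suc n) d′ _) _ =
  B ℕ.* suc d′ , λ T N≤T → lower T N≤T , upper T N≤T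
  where
  Q = suc q′
  toℚᵘ-W/Q+ : ∀ r → toℚᵘ (W / Q ℚ.+ r) ℚᵘ.≃ mkℚᵘ W q′ ℚᵘ.+ toℚᵘ r
  toℚᵘ-W/Q+ r = ℚᵘP.≃-trans (ℚP.toℚᵘ-homo-+ (W / Q) r) (ℚᵘP.+-cong (toℚᵘ-/ W q′) ℚᵘP.≃-refl)
  large : ∀ T → B ℕ.* suc d′ ℕ.≤ T → + B * + suc d′ ℤ.≤ + suc n * + Q * + suc T
  large T N≤T = subst (ℤ._≤ + suc n * + Q * + suc T) (ℤP.pos-* B (suc d′))
    (+≤+ (ℕP.≤-trans N≤T (ℕP.≤-trans (ℕP.n≤1+n T) (ℕP.m≤n*m (suc T) (suc n ℕ.* Q)))))
  lower : ∀ T → B ℕ.* suc d′ ℕ.≤ T → W / Q ℚ.- mkℚ (+ suc n) d′ _ ℚ.≤ avg f T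
  lower T N≤T = fraction-≤ (toℚᵘ-W/Q+ _) (toℚᵘ-/ (sumUpTo f (suc T)) T)
    (sandwich-lower W (sumUpTo f (suc T)) (+ B) (+ suc n) (+ Q) (+ suc T) (suc d′)
      (proj₁ (bounded (suc T))) (large T N≤T))
  upper : ∀ T → B ℕ.* suc d′ ℕ.≤ T → avg f T ℚ.≤ W / Q ℚ.+ mkℚ (+ suc n) d′ _
  upper T N≤T = fraction-≤ (toℚᵘ-/ (sumUpTo f (suc T)) T) (toℚᵘ-W/Q+ _)
    (sandwich-upper W (sumUpTo f (suc T)) (+ B) (+ suc n) (+ Q) (+ suc T) (suc d′)
      (proj₂ (bounded (suc T))) (large T N≤T))

module _ {p q′} {u : Vec ℤ p} {w : Vec ℤ (suc q′)} {f : ℕ → ℤ} (L : IsLasso u w f) where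

  -- Q·(f 0 + … + f (T-1)) − T·S(w), which a full period leaves unchanged.
  discrepancy : ℕ → ℤ
  discrepancy T = + suc q′ * sumUpTo f T - + T * S w

  discrepancy-periodic : EventuallyPeriodic p (suc q′) discrepancy
  discrepancy-periodic n = begin
      + suc q′ * sumUpTo f (p ℕ.+ n ℕ.+ suc q′) - + (p ℕ.+ n ℕ.+ suc q′) * S w
    ≡⟨ cong₂ (λ s t → + suc q′ * s - t * S w) (sumUpTo-period L n) (ℤP.pos-+ (p ℕ.+ n) (suc q′)) ⟩
      + suc q′ * (sumUpTo f (p ℕ.+ n) + S w) - (+ (p ℕ.+ n) + + suc q′) * S w
    ≡⟨ cancel (+ suc q′) (sumUpTo f (p ℕ.+ n)) (S w) (+ (p ℕ.+ n)) ⟩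
      + suc q′ * sumUpTo f (p ℕ.+ n) - + (p ℕ.+ n) * S w ∎
    where
    open ≡-Reasoning
    cancel : ∀ Q s W a → Q * (s + W) - (a + Q) * W ≡ Q * s - a * W
    cancel = solve-∀

  cesaro-lasso : Converges (avg f) (S w / suc q′)
  cesaro-lasso = bounded-discrepancy⇒converges f (S w) q′ B
    (λ T → abs-bounds (discrepancy T) B
             (periodic-bounded p (suc q′) ∣discrepancy∣ ∣discrepancy∣-periodic T))
    where
    ∣discrepancy∣ : ℕ → ℕ
    ∣discrepancy∣ T = ∣ discrepancy T ∣
    ∣discrepancy∣-periodic : EventuallyPeriodic p (suc q′) ∣discrepancy∣
    ∣discrepancy∣-periodic n = cong ∣_∣ (discrepancy-periodic n)
    B = sumBelow ∣discrepancy∣ (p ℕ.+ suc q′)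

  loop-sum-zero : IsLiminf (avg f) 0ℚ → S w ≡ 0ℤ
  loop-sum-zero liminf≡0 = /≡0ℚ⇒≡0ℤ (S w) q′ (limit-unique-liminf cesaro-lasso liminf≡0)

/-distribʳ-+ : ∀ a b q′ → (a + b) / suc q′ ≡ a / suc q′ ℚ.+ b / suc q′
/-distribʳ-+ a b q′ = ℚP.toℚᵘ-injective (begin
    toℚᵘ ((a + b) / suc q′)                ≈⟨ toℚᵘ-/ (a + b) q′ ⟩
    mkℚᵘ (a + b) q′                        ≈⟨ *≡* (identity a b (+ suc q′)) ⟩
    mkℚᵘ a q′ ℚᵘ.+ mkℚᵘ b q′               ≈⟨ ℚᵘP.+-cong (toℚᵘ-/ a q′) (toℚᵘ-/ b q′) ⟨
    toℚᵘ (a / suc q′) ℚᵘ.+ toℚᵘ (b / suc q′) ≈⟨ ℚP.toℚᵘ-homo-+ (a / suc q′) (b / suc q′) ⟨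
    toℚᵘ (a / suc q′ ℚ.+ b / suc q′)        ∎)
  where
  open ℚᵘP.≃-Reasoning
  identity : ∀ a b Q → (a + b) * (Q * Q) ≡ (a * Q + b * Q) * Q
  identity = solve-∀

lemma11 : (n : ℕ) (R : ℚ) (p q k : ℕ) .{{_ : NonZero q}} → 0 < p →
          (x : Vec ℤ p) (y : Vec ℤ q) → InS n R x y →
          (∀ ℓ → ℓ < k → φ≡ ℓ (lasso x y) 0ℚ) →
          (∀ i → iter k Ms (lasso x y) i ≡ lasso (iter k Mv x) (wvec k x y) i)
          × φ≡ k (lasso x y) (Afin (wvec k x y))
          × Afin (wvec k x y) ≡ S (wvec k x y) / q
          × S (wvec k x y) / q ≡ closedForm k x y
lemma11 n R p (suc q′) k _ x y _ φ≡0 = shape , average , refl , closed-form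
  where
  -- For ℓ ≤ k, M^ℓ(x(y)) is the lasso M^ℓ x (w_ℓ): induction on ℓ, using that
  -- φ^(ℓ) = 0 makes the loop of M^ℓ(x(y)) sum to zero for ℓ < k.
  lasso-iter : ∀ ℓ → ℓ ℕ.≤ k → IsLasso (iter ℓ Mv x) (wvec ℓ x y) (iter ℓ Ms (lasso x y))
  lasso-iter zero    _   = subst (λ w → IsLasso x w (lasso x y)) (sym (+v-identityˡ y)) (lasso-isLasso x y)
  lasso-iter (suc ℓ) ℓ<k =
    subst (λ w → IsLasso (iter (suc ℓ) Mv x) w (iter (suc ℓ) Ms (lasso x y))) (sym (wvec-suc ℓ x y))
      (Ms-isLasso previous (loop-sum-zero previous (φ≡0 ℓ ℓ<k)))
    where
    previous = lasso-iter ℓ (ℕP.<⇒≤ ℓ<k)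
  shape : ∀ i → iter k Ms (lasso x y) i ≡ lasso (iter k Mv x) (wvec k x y) i
  shape = isLasso-unique (lasso-iter k ℕP.≤-refl) (lasso-isLasso (iter k Mv x) (wvec k x y))
  average : φ≡ k (lasso x y) (Afin (wvec k x y))
  average = converges⇒liminf {c = Afin (wvec k x y)} (cesaro-lasso (lasso-iter k ℕP.≤-refl))
  closed-form : S (wvec k x y) / suc q′ ≡ closedForm k x y
  closed-form = trans (cong (_/ suc q′) (S-wvec k x y))
    (/-distribʳ-+ (ΣFin p _) (ΣFin (suc q′) (λ i → + ((k ℕ.+ (q′ ∸ toℕ i)) C k) * lookup y i)) q′)
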